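{- Let $G=(V,E)$ be a directed simple $st$-graph, $A\subseteq V$ and $a\in V\setminus A$. If $A\preceq a$ or $a\sqsubseteq A$, then $A\cup\{a\}\not\subseteq T$ for every minimal vertex separator $T$ of $G$.
   Context: A directed simple $st$-graph is a finite directed graph without self-loops or parallel edges, with distinguished source $s$ (no incoming edges) and sink $t\ne s$ (no outgoing edges), every vertex lying on some directed walk from $s$ to $t$. A minimal vertex separator (mvs) is an inclusion-minimal set $T\subseteq V$ such that every directed walk from $s$ to $t$ contains a vertex of $T$. For $A\subseteq V$ and $u\in V$: $u\sqsubseteq A$ ($u$ is covered by $A$) means every directed walk from $u$ to $t$ contains a vertex of $A$; $A\preceq u$ ($A$ precedes $u$) means every directed walk from $s$ to $u$ contains a vertex of $A$. -}

module Defs where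

open import Data.Nat using (ℕ)
open import Data.Fin using (Fin)
open import Data.Fin.Subset using (Subset; _∈_; _∉_; _⊆_; _∪_; ⁅_⁆)
open import Data.Product using (Σ; _×_; ∃; ∃-syntax)
open import Relation.Binary.PropositionalEquality using (_≡_)
open import Relation.Nullary using (¬_)

record DiGraph (n : ℕ) : Set₁ where
  field
    Edge : Fin n → Fin n → Set

module _ {n : ℕ} (G : DiGraph n) where
  open DiGraph G

  data Walk : Fin n → Fin n → Set where
    [_]  : (u : Fin n) → Walk u u
    _∷_ : ∀ {u v w} → Edge u v → Walk v w → Walk u w

  data OnWalk (x : Fin n) : ∀ {u v} → Walk u v → Set where
    here-[] : OnWalk x [ x ]
    here    : ∀ {v w} (e : Edge x v) (p : Walk v w) → OnWalk x (e ∷ p)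
    there   : ∀ {u v w} (e : Edge u v) {p : Walk v w} → OnWalk x p → OnWalk x (e ∷ p)

  Meets : ∀ {u v} → Walk u v → Subset n → Set
  Meets p A = ∃[ x ] (x ∈ A × OnWalk x p)

  record IsSTGraph (s t : Fin n) : Set where
    field
      noParallel : ∀ u v (e e′ : Edge u v) → e ≡ e′
      noLoops    : ∀ v → ¬ Edge v v
      sourceIn   : ∀ u → ¬ Edge u s
      sinkOut    : ∀ v → ¬ Edge t v
      s≢t        : ¬ (s ≡ t)
      onSTWalk   : ∀ v → Σ (Walk s t) (OnWalk v)

  IsSeparator : Fin n → Fin n → Subset n → Set
  IsSeparator s t T = (p : Walk s t) → Meets p T

  IsMVS : Fin n → Fin n → Subset n → Set
  IsMVS s t T = IsSeparator s t T × (∀ T′ → T′ ⊆ T → IsSeparator s t T′ → T ⊆ T′)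

  -- u ⊑ A : every walk from u to t contains a vertex of A
  CoveredBy : Fin n → Fin n → Subset n → Set
  CoveredBy t u A = (p : Walk u t) → Meets p A

  -- A ≼ u : every walk from s to u contains a vertex of A
  Precedes : Fin n → Subset n → Fin n → Set
  Precedes s A u = (p : Walk s u) → Meets p A

module Submission where

-- Let T be a minimal vertex separator containing A ∪ {a}.
-- Every s-t walk through a meets A: if A ≼ a, its prefix up to a does; if
-- a ⊑ A, its suffix from a does.  Since a ∉ A, these vertices of A lie in
-- T ─ {a}, so every s-t walk meets T ─ {a}: walks avoiding a meet T at a
-- vertex other than a, walks through a meet A.  Hence T ─ {a} is a
-- separator contained in T, and minimality forces T ⊆ T ─ {a}, which is
-- impossible because a ∈ T.

open import Defs
open import Data.Nat using (ℕ)
open import Data.Fin using (Fin; _≟_)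
open import Data.Fin.Subset using (Subset; _∈_; _∉_; _⊆_; _∪_; ⁅_⁆; _─_; inside; outside)
open import Data.Fin.Subset.Properties using (x∈p∧x∉q⇒x∈p─q; p─q⊆p; x≢y⇒x∉⁅y⁆; x∈⁅x⁆; x∈p∪q⁺)
open import Data.Sum using (_⊎_; inj₁; inj₂)
open import Data.Product using (_,_; proj₁)
open import Data.Vec using (_∷_; here; there)
open import Relation.Nullary using (¬_; yes; no)
open import Relation.Binary.PropositionalEquality using (refl)

x∈p─q⇒x∉q : ∀ {n} {x : Fin n} (p q : Subset n) → x ∈ p ─ q → x ∉ q
x∈p─q⇒x∉q (_ ∷ p) (inside  ∷ q) () here
x∈p─q⇒x∉q (_ ∷ p) (inside  ∷ q) (there x∈p─q) (there x∈q) = x∈p─q⇒x∉q p q x∈p─q x∈q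
x∈p─q⇒x∉q (_ ∷ p) (outside ∷ q) (there x∈p─q) (there x∈q) = x∈p─q⇒x∉q p q x∈p─q x∈q

module _ {n : ℕ} (G : DiGraph n) where
  open DiGraph G

  prefix : ∀ {x u v} (p : Walk G u v) → OnWalk G x p → Walk G u x
  prefix .([ _ ]) here-[]     = [ _ ]
  prefix .(e ∷ p) (here e p)  = [ _ ]
  prefix .(e ∷ _) (there e o) = e ∷ prefix _ o

  suffix : ∀ {x u v} (p : Walk G u v) → OnWalk G x p → Walk G x v
  suffix .([ _ ]) here-[]     = [ _ ]
  suffix .(e ∷ p) (here e p)  = e ∷ p
  suffix .(e ∷ _) (there e o) = suffix _ o

  onPrefix⇒onWalk : ∀ {x y u v} (p : Walk G u v) (o : OnWalk G x p) →
                    OnWalk G y (prefix p o) → OnWalk G y p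
  onPrefix⇒onWalk .([ _ ]) here-[]     here-[]      = here-[]
  onPrefix⇒onWalk .(e ∷ p) (here e p)  here-[]      = here e p
  onPrefix⇒onWalk .(e ∷ _) (there e o) (here .e _)  = here e _
  onPrefix⇒onWalk .(e ∷ _) (there e o) (there .e k) = there e (onPrefix⇒onWalk _ o k)

  onSuffix⇒onWalk : ∀ {x y u v} (p : Walk G u v) (o : OnWalk G x p) →
                    OnWalk G y (suffix p o) → OnWalk G y p
  onSuffix⇒onWalk .([ _ ]) here-[]     k = k
  onSuffix⇒onWalk .(e ∷ p) (here e p)  k = k
  onSuffix⇒onWalk .(e ∷ _) (there e o) k = there e (onSuffix⇒onWalk _ o k)

  meets-⊆ : ∀ {u v} {A B : Subset n} (p : Walk G u v) → A ⊆ B → Meets G p A → Meets G p B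
  meets-⊆ p A⊆B (y , y∈A , y-on-p) = y , A⊆B y∈A , y-on-p

  precedes⇒meets : ∀ {s v a} {A : Subset n} → Precedes G s A a →
                   (p : Walk G s v) → OnWalk G a p → Meets G p A
  precedes⇒meets A≼a p o with A≼a (prefix p o)
  ... | y , y∈A , k = y , y∈A , onPrefix⇒onWalk p o k

  covered⇒meets : ∀ {t u a} {A : Subset n} → CoveredBy G t a A →
                  (p : Walk G u t) → OnWalk G a p → Meets G p A
  covered⇒meets a⊑A p o with a⊑A (suffix p o)
  ... | y , y∈A , k = y , y∈A , onSuffix⇒onWalk p o k

  separator-─ : ∀ {s t a} {T : Subset n} → IsSeparator G s t T →
                ((p : Walk G s t) → OnWalk G a p → Meets G p (T ─ ⁅ a ⁆)) →
                IsSeparator G s t (T ─ ⁅ a ⁆)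
  separator-─ {a = a} sep through-a p with sep p
  ... | x , x∈T , x-on-p with x ≟ a
  ...   | no x≢a   = x , x∈p∧x∉q⇒x∈p─q x∈T (x≢y⇒x∉⁅y⁆ x≢a) , x-on-p
  ...   | yes refl = through-a p x-on-p

  mvs-irredundant : ∀ {s t a} {T : Subset n} → IsMVS G s t T →
                    IsSeparator G s t (T ─ ⁅ a ⁆) → a ∉ T
  mvs-irredundant {a = a} {T} (_ , minimal) sep′ a∈T =
    x∈p─q⇒x∉q T ⁅ a ⁆ (minimal (T ─ ⁅ a ⁆) (p─q⊆p T ⁅ a ⁆) sep′ a∈T) (x∈⁅x⁆ a)

lemma1 : {n : ℕ} (G : DiGraph n) (s t : Fin n) → IsSTGraph G s t →
    (A : Subset n) (a : Fin n) → a ∉ A →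
    Precedes G s A a ⊎ CoveredBy G t a A →
    (T : Subset n) → IsMVS G s t T → ¬ ((A ∪ ⁅ a ⁆) ⊆ T)
lemma1 G s t _ A a a∉A A≼a⊎a⊑A T mvs A∪a⊆T =
  mvs-irredundant G mvs (separator-─ G (proj₁ mvs) through-a) a∈T
  where
  a∈T : a ∈ T
  a∈T = A∪a⊆T (x∈p∪q⁺ (inj₂ (x∈⁅x⁆ a)))

  A⊆T─a : A ⊆ T ─ ⁅ a ⁆
  A⊆T─a y∈A = x∈p∧x∉q⇒x∈p─q (A∪a⊆T (x∈p∪q⁺ (inj₁ y∈A)))
                             (x≢y⇒x∉⁅y⁆ λ { refl → a∉A y∈A })

  through-a : (p : Walk G s t) → OnWalk G a p → Meets G p (T ─ ⁅ a ⁆)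
  through-a p o = meets-⊆ G p A⊆T─a (meets-A A≼a⊎a⊑A)
    where
    meets-A : Precedes G s A a ⊎ CoveredBy G t a A → Meets G p A
    meets-A (inj₁ A≼a) = precedes⇒meets G A≼a p o
    meets-A (inj₂ a⊑A) = covered⇒meets G a⊑A p o
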